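{- Let $\epsilon>0$. Consider an instance $\mathcal I$ of the single-machine problem in the context with $n$ jobs, let $P_{\max}$ be the maximum processing time of a job scheduled in some fixed optimal solution of $\mathcal I$, and let $K=2\epsilon P_{\max}/(n(n+1))$. Let $\mathcal I'$ be the instance obtained from $\mathcal I$ by discarding every job $j$ with $p_j>P_{\max}$ and replacing the processing time of every remaining job $j$ by $p'_j=\lceil p_j/K\rceil$ (profits and target $\Pi$ unchanged), and let $\mathcal J_{\mathcal I'}$ be the set of jobs of an optimal solution of $\mathcal I'$. Then scheduling the jobs of $\mathcal J_{\mathcal I'}$ (with their original processing times) in order of non-decreasing processing times gives a sum of completion times at most $(1+\epsilon)\mathsf{Opt}(\mathcal I)$.
   Context: Single-machine problem: there are $n$ jobs, job $j$ having processing time $p_j>0$ and profit $\pi_j\ge0$, all available at time $0$. Given a target $\Pi>0$, the goal is to choose a set $S$ of jobs with $\sum_{j\in S}\pi_j\ge\Pi$ and schedule them on a single machine so as to minimize $\sum_{j\in S}C_j$, where $C_j$ is the completion time of job $j$. $\mathsf{Opt}(\mathcal I)$ denotes the optimal value of instance $\mathcal I$.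
   Formalization: The processing times $p_j$, the profits $\pi_j$, the target $\Pi$ and the parameter $\epsilon$ are rational numbers. -}

module Defs where

open import Data.Nat using (ℕ; zero; suc)
open import Data.Integer using (ℤ; +_)
open import Data.Rational using (ℚ; 0ℚ; 1ℚ; _+_; _*_; _÷_; _⊔_; _/_; _≤_; ≢-nonZero; ceiling)
open import Data.Rational.Properties using (_≟_)
open import Data.Fin using (Fin)
open import Data.List using (List; []; _∷_; foldr)
open import Relation.Nullary using (yes; no)

-- A job set is Fin n; processing times / profits are functions Fin n → ℚ.
-- A schedule is a list of (distinct) jobs, processed back to back from time 0
-- in list order.

sumCompletionFrom : {n : ℕ} → (Fin n → ℚ) → ℚ → List (Fin n) → ℚ
sumCompletionFrom p t []       = 0ℚ
sumCompletionFrom p t (j ∷ js) = (t + p j) + sumCompletionFrom p (t + p j) js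

sumCompletion : {n : ℕ} → (Fin n → ℚ) → List (Fin n) → ℚ
sumCompletion p σ = sumCompletionFrom p 0ℚ σ

profit : {n : ℕ} → (Fin n → ℚ) → List (Fin n) → ℚ
profit π σ = foldr (λ j s → π j + s) 0ℚ σ

maxProc : {n : ℕ} → (Fin n → ℚ) → List (Fin n) → ℚ
maxProc p σ = foldr (λ j m → p j ⊔ m) 0ℚ σ

-- Total division on ℚ (returns 0 when dividing by 0; only used with a
-- positive divisor in the statement).
_÷₀_ : ℚ → ℚ → ℚ
a ÷₀ b with b ≟ 0ℚ
... | yes _  = 0ℚ
... | no b≢0 = _÷_ a b {{≢-nonZero b≢0}}

ℕtoℚ : ℕ → ℚ
ℕtoℚ m = (+ m) / 1

ℤtoℚ : ℤ → ℚ
ℤtoℚ z = z / 1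

scaleK : ℕ → ℚ → ℚ → ℚ
scaleK n ε Pmax = ((ℕtoℚ 2 * ε) * Pmax) ÷₀ (ℕtoℚ n * ℕtoℚ (suc n))

roundedProc : {n : ℕ} → (Fin n → ℚ) → ℚ → Fin n → ℚ
roundedProc p K j = ℤtoℚ (ceiling (p j ÷₀ K))

module Submission where

-- Let K > 0 and p′ⱼ = ⌈pⱼ/K⌉, so that pⱼ ≤ K·p′ⱼ ≤ pⱼ + K.  For any two
-- schedules σ, σ′ with Σ_{σ′} C′ ≤ Σ_σ C′ under p′ we get, under p,
--   Σ_{σ′} C ≤ K·Σ_{σ′} C′ ≤ K·Σ_σ C′ ≤ Σ_σ C + K·(1 + 2 + … + |σ|),
-- because lengthening every job by at most K delays the i-th completion
-- time by at most i·K.  With σ optimal for I (so |σ| ≤ n by distinctness),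
-- K = 2εPmax/(n(n+1)) and Pmax ≤ Σ_σ C, the error term is at most
-- ε·Pmax ≤ ε·Opt(I).  Finally, reordering σ′ by shortest processing time
-- first can only decrease Σ C (exchange argument).

open import Defs
open import Data.Nat as ℕ using (ℕ; zero; suc)
open import Data.Integer as ℤ using (ℤ; +_)
import Data.Integer.Properties as ℤP
import Data.Integer.DivMod as ℤD
open import Data.Integer.GCD using (gcd-zeroʳ)
import Data.Integer.Solver
import Data.Nat.Properties as ℕP
import Data.Nat.Coprimality as CP
open import Data.Rational
  using (ℚ; mkℚ; ↥_; ↧_; ↧ₙ_; 0ℚ; 1ℚ; _+_; _*_; -_; _/_; 1/_; _≤_; _<_; *≤*; ceiling; floor; ≢-nonZero; nonNegative; positive)
open import Data.Rational.Properties
import Data.Rational.Unnormalised as ℚᵘ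
import Data.Rational.Unnormalised.Properties as ℚᵘP
import Data.Rational.Solver
open import Data.Fin as Fin using (Fin)
import Data.Fin.Properties as FinP
open import Data.List using (List; []; _∷_; _++_; length; lookup)
open import Data.List.Relation.Unary.All as All using (All; []; _∷_)
open import Data.List.Relation.Unary.AllPairs using (_∷_)
open import Data.List.Relation.Unary.Any using (here; there)
open import Data.List.Relation.Unary.Unique.Propositional using (Unique)
open import Data.List.Relation.Unary.Linked as Linked using (Linked; _∷_)
open import Data.List.Relation.Unary.Linked.Properties using (Linked⇒All)
open import Data.List.Relation.Binary.Permutation.Propositional using (_↭_; ↭-sym)
open import Data.List.Relation.Binary.Permutation.Propositional.Properties
  using (↭-empty-inv; ∈-resp-↭; drop-mid)
open import Data.List.Membership.Propositional using (_∈_)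
open import Data.List.Membership.Propositional.Properties using (∈-∃++; ∈-++⁺ˡ; ∈-lookup)
open import Data.Product using (∃; _×_; _,_)
open import Data.Empty using (⊥-elim)
open import Relation.Nullary using (¬_; yes; no)
open import Relation.Binary.PropositionalEquality
open import Function using (_∘_)

module ℤS = Data.Integer.Solver.+-*-Solver
module ℚS = Data.Rational.Solver.+-*-Solver

-- ℤtoℚ z is the fraction z/1, already in lowest terms since gcd(z, 1) = 1.
↥-ℤtoℚ : ∀ z → ↥ (ℤtoℚ z) ≡ z
↥-ℤtoℚ z = trans (sym (ℤP.*-identityʳ _)) (trans (cong (↥ (z / 1) ℤ.*_) (sym (gcd-zeroʳ z))) (↥-/ z 1))

↧-ℤtoℚ : ∀ z → ↧ (ℤtoℚ z) ≡ ℤ.1ℤ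
↧-ℤtoℚ z = trans (sym (ℤP.*-identityʳ _)) (trans (cong (↧ (z / 1) ℤ.*_) (sym (gcd-zeroʳ z))) (↧-/ z 1))

ℤtoℚ-mkℚ : ∀ z → ℤtoℚ z ≡ mkℚ z 0 (CP.sym (CP.1-coprimeTo ℤ.∣ z ∣))
ℤtoℚ-mkℚ z with ℤtoℚ z | ↥-ℤtoℚ z | ↧-ℤtoℚ z
... | mkℚ _ _ _ | refl | refl = refl

floor-remainder : ∀ q → ↥ q ≡ + (↥ q ℤ.% ↧ q) ℤ.+ floor q ℤ.* ↧ q
floor-remainder (mkℚ n d _) = ℤD.a≡a%n+[a/n]*n n (+ suc d)

remainder< : ∀ q → ↥ q ℤ.% ↧ q ℕ.< ↧ₙ q
remainder< (mkℚ n d _) = ℤD.n%d<d n (+ suc d)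

-- Since ⌈y⌉ = -⌊-y⌋, writing y = n/d in lowest terms gives ⌈y⌉·d = n + r
-- for a remainder 0 ≤ r < d.
ceiling-remainder : ∀ y → ∃ λ r → r ℕ.< ↧ₙ y × ceiling y ℤ.* ↧ y ≡ ↥ y ℤ.+ + r
ceiling-remainder y@record{} = r , subst (r ℕ.<_) (cong ℤ.∣_∣ (↧-neg y)) (remainder< (- y)) , eq
  where
  r = ↥ (- y) ℤ.% ↧ (- y)
  f = floor (- y)
  negate : ∀ n r f d → ℤ.- n ≡ r ℤ.+ f ℤ.* d → (ℤ.- f) ℤ.* d ≡ n ℤ.+ r
  negate n r f d e = begin
    (ℤ.- f) ℤ.* d              ≡⟨ solve 3 (λ r f d → (:- f) :* d := :- (r :+ f :* d) :+ r) refl r f d ⟩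
    ℤ.- (r ℤ.+ f ℤ.* d) ℤ.+ r  ≡⟨ cong (λ m → ℤ.- m ℤ.+ r) (sym e) ⟩
    ℤ.- (ℤ.- n) ℤ.+ r          ≡⟨ cong (ℤ._+ r) (ℤP.neg-involutive n) ⟩
    n ℤ.+ r                    ∎
    where open ≡-Reasoning; open ℤS
  eq : ceiling y ℤ.* ↧ y ≡ ↥ y ℤ.+ + r
  eq = negate (↥ y) (+ r) f (↧ y)
         (trans (sym (↥-neg y)) (trans (floor-remainder (- y)) (cong (λ d → + r ℤ.+ f ℤ.* d) (↧-neg y))))

ceiling-lower : ∀ y → y ≤ ℤtoℚ (ceiling y)
ceiling-lower y with ceiling-remainder y
... | r , _ , eq = *≤* (begin
  ↥ y ℤ.* ↧ (ℤtoℚ c)  ≡⟨ cong (↥ y ℤ.*_) (↧-ℤtoℚ c) ⟩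
  ↥ y ℤ.* ℤ.1ℤ        ≡⟨ ℤP.*-identityʳ (↥ y) ⟩
  ↥ y                 ≤⟨ ℤP.i≤i+j (↥ y) (+ r) ⟩
  ↥ y ℤ.+ + r         ≡⟨ sym eq ⟩
  c ℤ.* ↧ y           ≡⟨ cong (ℤ._* ↧ y) (sym (↥-ℤtoℚ c)) ⟩
  ↥ (ℤtoℚ c) ℤ.* ↧ y  ∎)
  where
  c = ceiling y
  open ℤP.≤-Reasoning

-- The upper bound is checked in unnormalised rationals, where y + 1 = (n + d)/d.
ceiling-upper : ∀ y → ℤtoℚ (ceiling y) ≤ y + 1ℚ
ceiling-upper y@(mkℚ n d _) with ceiling-remainder y
... | r , r<d , eq = subst (_≤ y + 1ℚ) (sym (ℤtoℚ-mkℚ c))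
  (toℚᵘ-cancel-≤ (ℚᵘP.≤-respʳ-≃ (ℚᵘP.≃-sym (toℚᵘ-homo-+ y 1ℚ)) (ℚᵘ.*≤* cross)))
  where
  c = ceiling y
  D = + suc d
  open ℤP.≤-Reasoning
  cross : c ℤ.* (D ℤ.* ℤ.1ℤ) ℤ.≤ (n ℤ.* ℤ.1ℤ ℤ.+ ℤ.1ℤ ℤ.* D) ℤ.* ℤ.1ℤ
  cross = begin
    c ℤ.* (D ℤ.* ℤ.1ℤ)                   ≡⟨ cong (c ℤ.*_) (ℤP.*-identityʳ D) ⟩
    c ℤ.* D                              ≡⟨ eq ⟩
    n ℤ.+ + r                            ≤⟨ ℤP.+-monoʳ-≤ n (ℤ.+≤+ (ℕP.<⇒≤ r<d)) ⟩
    n ℤ.+ D                              ≡⟨ sym (cong₂ ℤ._+_ (ℤP.*-identityʳ n) (ℤP.*-identityˡ D)) ⟩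
    n ℤ.* ℤ.1ℤ ℤ.+ ℤ.1ℤ ℤ.* D            ≡⟨ sym (ℤP.*-identityʳ _) ⟩
    (n ℤ.* ℤ.1ℤ ℤ.+ ℤ.1ℤ ℤ.* D) ℤ.* ℤ.1ℤ ∎

ℕtoℚ-mono : ∀ {a b} → a ℕ.≤ b → ℕtoℚ a ≤ ℕtoℚ b
ℕtoℚ-mono {a} {b} a≤b = *≤* (begin
  ↥ (ℕtoℚ a) ℤ.* ↧ (ℕtoℚ b)  ≡⟨ cong₂ ℤ._*_ (↥-ℤtoℚ (+ a)) (↧-ℤtoℚ (+ b)) ⟩
  + a ℤ.* ℤ.1ℤ               ≤⟨ ℤP.*-monoʳ-≤-nonNeg ℤ.1ℤ (ℤ.+≤+ a≤b) ⟩
  + b ℤ.* ℤ.1ℤ               ≡⟨ sym (cong₂ ℤ._*_ (↥-ℤtoℚ (+ b)) (↧-ℤtoℚ (+ a))) ⟩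
  ↥ (ℕtoℚ b) ℤ.* ↧ (ℕtoℚ a)  ∎)
  where open ℤP.≤-Reasoning

ℕtoℚ-suc : ∀ m → ℕtoℚ (suc m) ≡ ℕtoℚ m + 1ℚ
ℕtoℚ-suc m = begin
  ℤtoℚ (+ suc m)                     ≡⟨ cong ℤtoℚ (sym (trans (cong (ℤ._+ ℤ.1ℤ) (ℤP.*-identityʳ (+ m))) (ℤP.+-comm (+ m) ℤ.1ℤ))) ⟩
  ℤtoℚ (+ m ℤ.* ℤ.1ℤ ℤ.+ ℤ.1ℤ)       ≡⟨⟩
  mkℚ (+ m) 0 (CP.sym (CP.1-coprimeTo m)) + 1ℚ ≡⟨ cong (_+ 1ℚ) (sym (ℤtoℚ-mkℚ (+ m))) ⟩
  ℕtoℚ m + 1ℚ                        ∎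
  where open ≡-Reasoning

÷₀-cancel : ∀ a b → ¬ (b ≡ 0ℚ) → b * (a ÷₀ b) ≡ a
÷₀-cancel a b b≢0 with b ≟ 0ℚ
... | yes b≡0 = ⊥-elim (b≢0 b≡0)
... | no b≢0′ = begin
  b * (a * 1/ b)  ≡⟨ cong (b *_) (*-comm a (1/ b)) ⟩
  b * (1/ b * a)  ≡⟨ sym (*-assoc b (1/ b) a) ⟩
  b * 1/ b * a    ≡⟨ cong (_* a) (*-inverseʳ b) ⟩
  1ℚ * a          ≡⟨ *-identityˡ a ⟩
  a               ∎
  where
  open ≡-Reasoning
  instance _ = ≢-nonZero b≢0′

round-up-lower : ∀ K x → 0ℚ < K → x ≤ K * ℤtoℚ (ceiling (x ÷₀ K))
round-up-lower K x K>0 = subst (_≤ K * ℤtoℚ (ceiling (x ÷₀ K))) (÷₀-cancel x K (<⇒≢ K>0 ∘ sym))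
  (*-monoˡ-≤-nonNeg K {{nonNegative (<⇒≤ K>0)}} (ceiling-lower (x ÷₀ K)))

round-up-upper : ∀ K x → 0ℚ < K → K * ℤtoℚ (ceiling (x ÷₀ K)) ≤ x + K
round-up-upper K x K>0 = begin
  K * ℤtoℚ (ceiling (x ÷₀ K))  ≤⟨ *-monoˡ-≤-nonNeg K {{nonNegative (<⇒≤ K>0)}} (ceiling-upper (x ÷₀ K)) ⟩
  K * (x ÷₀ K + 1ℚ)            ≡⟨ *-distribˡ-+ K (x ÷₀ K) 1ℚ ⟩
  K * (x ÷₀ K) + K * 1ℚ        ≡⟨ cong₂ _+_ (÷₀-cancel x K (<⇒≢ K>0 ∘ sym)) (*-identityʳ K) ⟩
  x + K                        ∎
  where open ≤-Reasoning

p≤p+q : ∀ p {q} → 0ℚ ≤ q → p ≤ p + q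
p≤p+q p {q} q≥0 = subst (_≤ p + q) (+-identityʳ p) (+-monoʳ-≤ p q≥0)

p≤q+p : ∀ p {q} → 0ℚ ≤ q → p ≤ q + p
p≤q+p p {q} q≥0 = subst (_≤ q + p) (+-identityˡ p) (+-monoˡ-≤ p q≥0)

sumCompletionFrom-mono : ∀ {n} {p q : Fin n → ℚ} → (∀ j → p j ≤ q j) →
  ∀ {t t′} js → t ≤ t′ → sumCompletionFrom p t js ≤ sumCompletionFrom q t′ js
sumCompletionFrom-mono p≤q []       _    = ≤-refl
sumCompletionFrom-mono p≤q (j ∷ js) t≤t′ =
  +-mono-≤ Cⱼ≤ (sumCompletionFrom-mono p≤q js Cⱼ≤)
  where Cⱼ≤ = +-mono-≤ t≤t′ (p≤q j)

sumCompletionFrom-scale : ∀ {n} K (p : Fin n → ℚ) t js →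
  sumCompletionFrom (λ j → K * p j) (K * t) js ≡ K * sumCompletionFrom p t js
sumCompletionFrom-scale K p t []       = sym (*-zeroʳ K)
sumCompletionFrom-scale K p t (j ∷ js) = begin
  (K * t + K * p j) + sumCompletionFrom (λ i → K * p i) (K * t + K * p j) js
    ≡⟨ cong (λ s → s + sumCompletionFrom (λ i → K * p i) s js) Kt+Kp ⟩
  K * (t + p j) + sumCompletionFrom (λ i → K * p i) (K * (t + p j)) js
    ≡⟨ cong (λ s → K * (t + p j) + s) (sumCompletionFrom-scale K p (t + p j) js) ⟩
  K * (t + p j) + K * sumCompletionFrom p (t + p j) js
    ≡⟨ sym (*-distribˡ-+ K (t + p j) _) ⟩
  K * ((t + p j) + sumCompletionFrom p (t + p j) js) ∎
  where
  open ≡-Reasoning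
  Kt+Kp = sym (*-distribˡ-+ K t (p j))

sumCompletion-scale : ∀ {n} K (p : Fin n → ℚ) js →
  sumCompletion (λ j → K * p j) js ≡ K * sumCompletion p js
sumCompletion-scale K p js =
  trans (cong (λ t → sumCompletionFrom (λ j → K * p j) t js) (sym (*-zeroʳ K)))
        (sumCompletionFrom-scale K p 0ℚ js)

-- delay c m = (c + 1) + (c + 2) + … + (c + m): a bound, in units of K, on the
-- total growth of m consecutive completion times when the start is c·K late
-- and each job is lengthened by at most K.
delay : ℚ → ℕ → ℚ
delay c zero    = 0ℚ
delay c (suc m) = (c + 1ℚ) + delay (c + 1ℚ) m

delay-closed : ∀ c m → (1ℚ + 1ℚ) * delay c m ≡ (1ℚ + 1ℚ) * ℕtoℚ m * c + ℕtoℚ m * (ℕtoℚ m + 1ℚ)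
delay-closed c zero    = solve 1 (λ c → two :* con 0ℚ := two :* con 0ℚ :* c :+ con 0ℚ :* (con 0ℚ :+ con 1ℚ)) refl c
  where open ℚS; two = con 1ℚ :+ con 1ℚ
delay-closed c (suc m) = begin
  (1ℚ + 1ℚ) * ((c + 1ℚ) + delay (c + 1ℚ) m)
    ≡⟨ *-distribˡ-+ (1ℚ + 1ℚ) (c + 1ℚ) _ ⟩
  (1ℚ + 1ℚ) * (c + 1ℚ) + (1ℚ + 1ℚ) * delay (c + 1ℚ) m
    ≡⟨ cong (λ s → (1ℚ + 1ℚ) * (c + 1ℚ) + s) (delay-closed (c + 1ℚ) m) ⟩
  (1ℚ + 1ℚ) * (c + 1ℚ) + ((1ℚ + 1ℚ) * x * (c + 1ℚ) + x * (x + 1ℚ))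
    ≡⟨ solve 2 (λ c x → two :* (c :+ con 1ℚ) :+ (two :* x :* (c :+ con 1ℚ) :+ x :* (x :+ con 1ℚ))
                     := two :* (x :+ con 1ℚ) :* c :+ (x :+ con 1ℚ) :* (x :+ con 1ℚ :+ con 1ℚ)) refl c x ⟩
  (1ℚ + 1ℚ) * (x + 1ℚ) * c + (x + 1ℚ) * (x + 1ℚ + 1ℚ)
    ≡⟨ sym (cong (λ y → (1ℚ + 1ℚ) * y * c + y * (y + 1ℚ)) (ℕtoℚ-suc m)) ⟩
  (1ℚ + 1ℚ) * ℕtoℚ (suc m) * c + ℕtoℚ (suc m) * (ℕtoℚ (suc m) + 1ℚ) ∎
  where
  open ≡-Reasoning
  open ℚS using (solve; _:+_; _:*_; _:=_; con)
  x = ℕtoℚ m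
  two = con 1ℚ :+ con 1ℚ

sumCompletionFrom-perturb : ∀ {n} K {p q : Fin n → ℚ} → (∀ j → q j ≤ p j + K) →
  ∀ c {t t′} js → t′ ≤ t + c * K →
  sumCompletionFrom q t′ js ≤ sumCompletionFrom p t js + delay c (length js) * K
sumCompletionFrom-perturb K q≤p+K c {t} {t′} [] _ =
  ≤-reflexive (sym (trans (+-identityˡ _) (*-zeroˡ K)))
sumCompletionFrom-perturb K {p} {q} q≤p+K c {t} {t′} (j ∷ js) t′≤ = begin
  (t′ + q j) + sumCompletionFrom q (t′ + q j) js
    ≤⟨ +-mono-≤ Cⱼ≤ (sumCompletionFrom-perturb K q≤p+K (c + 1ℚ) js Cⱼ≤) ⟩
  (Cⱼ + (c + 1ℚ) * K) + (sumCompletionFrom p Cⱼ js + delay (c + 1ℚ) (length js) * K)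
    ≡⟨ regroup Cⱼ (c + 1ℚ) _ _ K ⟩
  (Cⱼ + sumCompletionFrom p Cⱼ js) + ((c + 1ℚ) + delay (c + 1ℚ) (length js)) * K ∎
  where
  open ≤-Reasoning
  open ℚS using (solve; _:+_; _:*_; _:=_; con)
  Cⱼ = t + p j
  regroup : ∀ a u s g k → (a + u * k) + (s + g * k) ≡ (a + s) + (u + g) * k
  regroup = solve 5 (λ a u s g k → (a :+ u :* k) :+ (s :+ g :* k) := (a :+ s) :+ (u :+ g) :* k) refl
  late : ∀ t c x k → (t + c * k) + (x + k) ≡ (t + x) + (c + 1ℚ) * k
  late = solve 4 (λ t c x k → (t :+ c :* k) :+ (x :+ k) := (t :+ x) :+ (c :+ con 1ℚ) :* k) refl
  Cⱼ≤ : t′ + q j ≤ Cⱼ + (c + 1ℚ) * K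
  Cⱼ≤ = ≤-trans (+-mono-≤ t′≤ (q≤p+K j)) (≤-reflexive (late t c (p j) K))

move-to-front : ∀ {n} (p : Fin n → ℚ) r t a b → All (λ x → p r ≤ p x) a →
  sumCompletionFrom p t (r ∷ a ++ b) ≤ sumCompletionFrom p t (a ++ r ∷ b)
move-to-front p r t []      b _            = ≤-refl
move-to-front p r t (x ∷ a) b (r≤x ∷ r≤a) = begin
  (t + p r) + (((t + p r) + p x) + sumCompletionFrom p ((t + p r) + p x) (a ++ b))
    ≡⟨ cong (λ s → (t + p r) + (s + sumCompletionFrom p s (a ++ b))) swap ⟩
  (t + p r) + (((t + p x) + p r) + sumCompletionFrom p ((t + p x) + p r) (a ++ b))
    ≤⟨ +-monoˡ-≤ _ (+-monoʳ-≤ t r≤x) ⟩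
  (t + p x) + sumCompletionFrom p (t + p x) (r ∷ a ++ b)
    ≤⟨ +-monoʳ-≤ (t + p x) (move-to-front p r (t + p x) a b r≤a) ⟩
  (t + p x) + sumCompletionFrom p (t + p x) (a ++ r ∷ b) ∎
  where
  open ≤-Reasoning
  swap : (t + p r) + p x ≡ (t + p x) + p r
  swap = ℚS.solve 3 (λ t a b → (t ℚS.:+ a) ℚS.:+ b ℚS.:= (t ℚS.:+ b) ℚS.:+ a) refl t (p r) (p x)

sorted-head-least : ∀ {n} (p : Fin n → ℚ) r ρ → Linked (λ i j → p i ≤ p j) (r ∷ ρ) →
  ∀ {x} → x ∈ r ∷ ρ → p r ≤ p x
sorted-head-least p r ρ       _           (here refl) = ≤-refl
sorted-head-least p r (y ∷ ρ) (r≤y ∷ lk) (there x∈)  = All.lookup (Linked⇒All ≤-trans r≤y lk) x∈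

spt-optimal : ∀ {n} (p : Fin n → ℚ) t ρ τ → ρ ↭ τ → Linked (λ i j → p i ≤ p j) ρ →
  sumCompletionFrom p t ρ ≤ sumCompletionFrom p t τ
spt-optimal p t [] τ ρ↭τ _ rewrite ↭-empty-inv (↭-sym ρ↭τ) = ≤-refl
spt-optimal p t (r ∷ ρ) τ ρ↭τ sorted with ∈-∃++ (∈-resp-↭ ρ↭τ (here refl))
... | a , b , refl = begin
  sumCompletionFrom p t (r ∷ ρ)       ≤⟨ +-monoʳ-≤ (t + p r) tail-optimal ⟩
  sumCompletionFrom p t (r ∷ a ++ b)  ≤⟨ move-to-front p r t a b r-least ⟩
  sumCompletionFrom p t (a ++ r ∷ b)  ∎
  where
  open ≤-Reasoning
  tail-optimal = spt-optimal p (t + p r) ρ (a ++ b) (drop-mid [] a ρ↭τ) (Linked.tail sorted)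
  r-least : All (λ x → p r ≤ p x) a
  r-least = All.tabulate λ x∈a →
    sorted-head-least p r ρ sorted (∈-resp-↭ (↭-sym ρ↭τ) (∈-++⁺ˡ x∈a))

maxProc-upper : ∀ {n} (p : Fin n → ℚ) js → All (λ j → p j ≤ maxProc p js) js
maxProc-upper p []       = []
maxProc-upper p (j ∷ js) =
  p≤p⊔q (p j) (maxProc p js) ∷ All.map (λ le → ≤-trans le (p≤q⊔p (p j) _)) (maxProc-upper p js)

sumCompletionFrom-nonNeg : ∀ {n} (p : Fin n → ℚ) → (∀ j → 0ℚ ≤ p j) →
  ∀ {t} js → 0ℚ ≤ t → 0ℚ ≤ sumCompletionFrom p t js
sumCompletionFrom-nonNeg p p≥0 []       _   = ≤-refl
sumCompletionFrom-nonNeg p p≥0 {t} (j ∷ js) t≥0 =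
  ≤-trans Cⱼ≥0 (p≤p+q _ (sumCompletionFrom-nonNeg p p≥0 js Cⱼ≥0))
  where Cⱼ≥0 = ≤-trans t≥0 (p≤p+q t (p≥0 j))

-- The longest job finishes no earlier than its own length, so Pmax ≤ Σ C.
maxProc≤sumCompletionFrom : ∀ {n} (p : Fin n → ℚ) → (∀ j → 0ℚ ≤ p j) →
  ∀ {t} js → 0ℚ ≤ t → maxProc p js ≤ sumCompletionFrom p t js
maxProc≤sumCompletionFrom p p≥0 []       _   = ≤-refl
maxProc≤sumCompletionFrom p p≥0 {t} (j ∷ js) t≥0 = ⊔-lub
  (≤-trans (p≤q+p (p j) t≥0) (p≤p+q _ (sumCompletionFrom-nonNeg p p≥0 js Cⱼ≥0)))
  (≤-trans (maxProc≤sumCompletionFrom p p≥0 js Cⱼ≥0) (p≤q+p _ Cⱼ≥0))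
  where Cⱼ≥0 = ≤-trans t≥0 (p≤p+q t (p≥0 j))

unique-lookup-injective : ∀ {A : Set} {xs : List A} → Unique xs →
  ∀ {i j : Fin (length xs)} → i Fin.< j → ¬ (lookup xs i ≡ lookup xs j)
unique-lookup-injective {xs = x ∷ xs} (x∉xs ∷ _) {Fin.zero}  {Fin.suc j} _ = All.lookup x∉xs (∈-lookup j)
unique-lookup-injective {xs = x ∷ xs} (_ ∷ u) {Fin.suc i} {Fin.suc j} (ℕ.s≤s i<j) =
  unique-lookup-injective u i<j

unique-length : ∀ {n} (js : List (Fin n)) → Unique js → length js ℕ.≤ n
unique-length {n} js u with length js ℕ.≤? n
... | yes ≤n = ≤n
... | no ≰n with FinP.pigeonhole (ℕP.≰⇒> ≰n) (lookup js)
...   | i , j , i<j , same = ⊥-elim (unique-lookup-injective u i<j same)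

rounded-schedule-bound : ∀ {n} (p : Fin n → ℚ) K → 0ℚ < K → (σ σ′ : List (Fin n)) →
  sumCompletion (roundedProc p K) σ′ ≤ sumCompletion (roundedProc p K) σ →
  sumCompletion p σ′ ≤ sumCompletion p σ + delay 0ℚ (length σ) * K
rounded-schedule-bound p K K>0 σ σ′ σ′≤σ = begin
  sumCompletion p σ′          ≤⟨ sumCompletionFrom-mono (λ j → round-up-lower K (p j) K>0) σ′ ≤-refl ⟩
  sumCompletion Kp′ σ′        ≡⟨ sumCompletion-scale K p′ σ′ ⟩
  K * sumCompletion p′ σ′     ≤⟨ *-monoˡ-≤-nonNeg K {{nonNegative (<⇒≤ K>0)}} σ′≤σ ⟩
  K * sumCompletion p′ σ      ≡⟨ sym (sumCompletion-scale K p′ σ) ⟩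
  sumCompletion Kp′ σ         ≤⟨ sumCompletionFrom-perturb K (λ j → round-up-upper K (p j) K>0) 0ℚ σ on-time ⟩
  sumCompletion p σ + delay 0ℚ (length σ) * K ∎
  where
  open ≤-Reasoning
  p′ = roundedProc p K
  Kp′ : Fin _ → ℚ
  Kp′ j = K * p′ j
  on-time : 0ℚ ≤ 0ℚ + 0ℚ * K
  on-time = ≤-reflexive (sym (trans (+-identityˡ _) (*-zeroˡ K)))

pronic : ℕ → ℚ
pronic n = ℕtoℚ n * ℕtoℚ (suc n)

ℕtoℚ-nonNeg : ∀ m → 0ℚ ≤ ℕtoℚ m
ℕtoℚ-nonNeg m = ℕtoℚ-mono {0} {m} ℕ.z≤n

delay-pronic : ∀ m → (1ℚ + 1ℚ) * delay 0ℚ m ≡ pronic m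
delay-pronic m = begin
  (1ℚ + 1ℚ) * delay 0ℚ m                          ≡⟨ delay-closed 0ℚ m ⟩
  (1ℚ + 1ℚ) * x * 0ℚ + x * (x + 1ℚ)               ≡⟨ ℚS.solve 1 (λ x → two :* x :* con 0ℚ :+ x :* (x :+ con 1ℚ) := x :* (x :+ con 1ℚ)) refl x ⟩
  x * (x + 1ℚ)                                    ≡⟨ cong (x *_) (sym (ℕtoℚ-suc m)) ⟩
  pronic m                                        ∎
  where
  open ≡-Reasoning
  open ℚS using (_:+_; _:*_; _:=_; con)
  x = ℕtoℚ m
  two = con 1ℚ :+ con 1ℚ

pronic-mono : ∀ {m n} → m ℕ.≤ n → pronic m ≤ pronic n
pronic-mono {m} {n} m≤n = begin
  ℕtoℚ m * ℕtoℚ (suc m)  ≤⟨ *-monoʳ-≤-nonNeg (ℕtoℚ (suc m)) {{nonNegative (ℕtoℚ-nonNeg (suc m))}} (ℕtoℚ-mono m≤n) ⟩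
  ℕtoℚ n * ℕtoℚ (suc m)  ≤⟨ *-monoˡ-≤-nonNeg (ℕtoℚ n) {{nonNegative (ℕtoℚ-nonNeg n)}} (ℕtoℚ-mono (ℕ.s≤s m≤n)) ⟩
  ℕtoℚ n * ℕtoℚ (suc n)  ∎
  where open ≤-Reasoning

pronic-pos : ∀ {n} → 0 ℕ.< n → 0ℚ < pronic n
pronic-pos {n} 0<n = <-≤-trans (positive⁻¹ (pronic 1)) (pronic-mono 0<n)

scaleK-spec : ∀ n ε P → 0 ℕ.< n → scaleK n ε P * pronic n ≡ ℕtoℚ 2 * ε * P
scaleK-spec n ε P 0<n =
  trans (*-comm (scaleK n ε P) (pronic n)) (÷₀-cancel (ℕtoℚ 2 * ε * P) (pronic n) (<⇒≢ (pronic-pos 0<n) ∘ sym))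

scaleK-pos : ∀ n ε P → 0 ℕ.< n → 0ℚ < ε → 0ℚ < P → 0ℚ < scaleK n ε P
scaleK-pos n ε P 0<n ε>0 P>0 = *-cancelʳ-<-nonNeg (pronic n) {{nonNegative (<⇒≤ (pronic-pos 0<n))}} (begin-strict
  0ℚ * pronic n            ≡⟨ *-zeroˡ (pronic n) ⟩
  0ℚ                       <⟨ pos*pos ⟩
  ℕtoℚ 2 * ε * P           ≡⟨ sym (scaleK-spec n ε P 0<n) ⟩
  scaleK n ε P * pronic n  ∎)
  where
  open ≤-Reasoning
  pos*pos = positive⁻¹ _ {{pos*pos⇒pos (ℕtoℚ 2 * ε) {{pos*pos⇒pos (ℕtoℚ 2) ε {{positive ε>0}}}} P {{positive P>0}}}}

scaleK-error : ∀ {m} n ε P → m ℕ.≤ n → 0 ℕ.< n → 0ℚ < ε → 0ℚ < P → delay 0ℚ m * scaleK n ε P ≤ ε * P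
scaleK-error {m} n ε P m≤n 0<n ε>0 P>0 = *-cancelˡ-≤-pos (1ℚ + 1ℚ) (begin
  (1ℚ + 1ℚ) * (delay 0ℚ m * K)  ≡⟨ sym (*-assoc (1ℚ + 1ℚ) (delay 0ℚ m) K) ⟩
  (1ℚ + 1ℚ) * delay 0ℚ m * K    ≡⟨ cong (_* K) (delay-pronic m) ⟩
  pronic m * K                  ≤⟨ *-monoʳ-≤-nonNeg K {{nonNegative (<⇒≤ (scaleK-pos n ε P 0<n ε>0 P>0))}} (pronic-mono m≤n) ⟩
  pronic n * K                  ≡⟨ trans (*-comm (pronic n) K) (scaleK-spec n ε P 0<n) ⟩
  (1ℚ + 1ℚ) * ε * P             ≡⟨ *-assoc (1ℚ + 1ℚ) ε P ⟩
  (1ℚ + 1ℚ) * (ε * P)           ∎)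
  where
  open ≤-Reasoning
  K = scaleK n ε P

fin-pos : ∀ {n} → Fin n → 0 ℕ.< n
fin-pos {suc _} _ = ℕ.s≤s ℕ.z≤n

-- Theorem 3.4.  σ is optimal for I, σ′ for the rounded instance I′ (σ is
-- feasible for I′), and ρ is σ′ in SPT order.  σ is nonempty, as 0 < Π.
theorem3p4 : (n : ℕ) (p π : Fin n → ℚ) (Π ε : ℚ) →
    (∀ j → 0ℚ < p j) → (∀ j → 0ℚ ≤ π j) → 0ℚ < Π → 0ℚ < ε →
    (σ : List (Fin n)) → Unique σ → Π ≤ profit π σ →
    (∀ (τ : List (Fin n)) → Unique τ → Π ≤ profit π τ →
       sumCompletion p σ ≤ sumCompletion p τ) →
    (σ' : List (Fin n)) → Unique σ' →
    All (λ j → p j ≤ maxProc p σ) σ' → Π ≤ profit π σ' →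
    (∀ (τ : List (Fin n)) → Unique τ →
       All (λ j → p j ≤ maxProc p σ) τ → Π ≤ profit π τ →
       sumCompletion (roundedProc p (scaleK n ε (maxProc p σ))) σ'
         ≤ sumCompletion (roundedProc p (scaleK n ε (maxProc p σ))) τ) →
    (ρ : List (Fin n)) → ρ ↭ σ' → Linked (λ i j → p i ≤ p j) ρ →
    sumCompletion p ρ ≤ (1ℚ + ε) * sumCompletion p σ
theorem3p4 _ _ _ _ _ _ _ Π>0 _ [] _ Π≤0 _ _ _ _ _ _ _ _ _ = ⊥-elim (<-irrefl refl (<-≤-trans Π>0 Π≤0))
theorem3p4 n p π Π ε p>0 _ _ ε>0 σ@(j₀ ∷ _) uσ Πσ _ σ′ _ _ _ σ′-optimal ρ ρ↭σ′ sorted = begin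
  sumCompletion p ρ         ≤⟨ spt-optimal p 0ℚ ρ σ′ ρ↭σ′ sorted ⟩
  sumCompletion p σ′        ≤⟨ rounded-schedule-bound p K K>0 σ σ′ (σ′-optimal σ uσ (maxProc-upper p σ) Πσ) ⟩
  S + delay 0ℚ m * K        ≤⟨ +-monoʳ-≤ S (scaleK-error n ε P (unique-length σ uσ) 0<n ε>0 P>0) ⟩
  S + ε * P                 ≤⟨ +-monoʳ-≤ S (*-monoˡ-≤-nonNeg ε {{nonNegative (<⇒≤ ε>0)}} P≤S) ⟩
  S + ε * S                 ≡⟨ ℚS.solve 2 (λ s e → s ℚS.:+ e ℚS.:* s ℚS.:= (ℚS.con 1ℚ ℚS.:+ e) ℚS.:* s) refl S ε ⟩
  (1ℚ + ε) * S              ∎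
  where
  open ≤-Reasoning
  P = maxProc p σ
  K = scaleK n ε P
  S = sumCompletion p σ
  m = length σ
  0<n = fin-pos j₀
  P>0 = <-≤-trans (p>0 j₀) (All.head (maxProc-upper p σ))
  K>0 = scaleK-pos n ε P 0<n ε>0 P>0
  P≤S = maxProc≤sumCompletionFrom p (<⇒≤ ∘ p>0) σ ≤-refl
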